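{- Let $G=(V,E)$ be a finite simple graph. If $G$ has a $C_3$-free vertex $x$ (that is, a non-isolated vertex $x$ that belongs to no triangle of $G$), then $G$ is not a universal fixer.
   Context: All graphs are finite, simple and undirected. For $v\in V(G)$, $N_G(v)$ denotes the set of neighbours of $v$, and $N_G[D]=D\cup\bigcup_{v\in D}N_G(v)$ for $D\subseteq V(G)$. A set $D\subseteq V(G)$ is a dominating set if $N_G[D]=V(G)$; the domination number $\gamma(G)$ is the minimum cardinality of a dominating set. Let $G'$ be a disjoint copy of $G$, the copy of $v\in V(G)$ being $v'$. For a bijection $\pi:V(G)\to V(G')$, the prism $\pi G$ is the graph with vertex set $V(G)\cup V(G')$ and edge set $E(G)\cup E(G')\cup\{u\pi(u): u\in V(G)\}$. The graph $G$ is called a universal fixer if $\gamma(\pi G)=\gamma(G)$ for every bijection $\pi:V(G)\to V(G')$. -}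

module Defs where

open import Level using (0ℓ)
open import Data.Nat using (ℕ; _+_; _<_)
open import Data.Fin using (Fin; splitAt)
open import Data.Fin.Subset using (Subset; _∈_; ∣_∣)
open import Data.Sum using (_⊎_; inj₁; inj₂)
open import Data.Product using (Σ; ∃; _×_; _,_)
open import Data.Empty using (⊥)
open import Relation.Nullary using (¬_)
open import Relation.Binary.PropositionalEquality using (_≡_)
open import Function.Bundles using (_↔_; _⇔_; Inverse)

record Graph (n : ℕ) : Set₁ where
  field
    Adj     : Fin n → Fin n → Set
    symm    : ∀ {u v} → Adj u v → Adj v u
    irrefl  : ∀ {u} → ¬ Adj u u
open Graph public

Dominating : ∀ {n} → Graph n → Subset n → Set
Dominating {n} G D = ∀ (v : Fin n) → v ∈ D ⊎ ∃ λ u → u ∈ D × Adj G u v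

IsDominationNumber : ∀ {n} → Graph n → ℕ → Set
IsDominationNumber {n} G k =
  (∃ λ (D : Subset n) → Dominating G D × ∣ D ∣ ≡ k) ×
  (∀ (D : Subset n) → Dominating G D → ¬ (∣ D ∣ < k))

-- V(πG) = Fin (n + n):
-- the first n vertices are V(G), the last n are the copy V(G') (v ↦ v').
-- A bijection V(G) → V(G') is given as a permutation σ of Fin n, π(u) = σ(u)'.
prismAdj : ∀ {n} → Graph n → (Fin n ↔ Fin n) → Fin (n + n) → Fin (n + n) → Set
prismAdj {n} G σ a b with splitAt n a | splitAt n b
... | inj₁ u | inj₁ v = Adj G u v
... | inj₂ u | inj₂ v = Adj G u v
... | inj₁ u | inj₂ v = Inverse.to σ u ≡ v
... | inj₂ u | inj₁ v = Inverse.to σ v ≡ u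

prismSymm : ∀ {n} (G : Graph n) (σ : Fin n ↔ Fin n) {a b} →
            prismAdj G σ a b → prismAdj G σ b a
prismSymm {n} G σ {a} {b} p with splitAt n a | splitAt n b
... | inj₁ u | inj₁ v = symm G p
... | inj₂ u | inj₂ v = symm G p
... | inj₁ u | inj₂ v = p
... | inj₂ u | inj₁ v = p

prismIrrefl : ∀ {n} (G : Graph n) (σ : Fin n ↔ Fin n) {a} → ¬ prismAdj G σ a a
prismIrrefl {n} G σ {a} p with splitAt n a
... | inj₁ u = irrefl G p
... | inj₂ u = irrefl G p

prism : ∀ {n} → Graph n → (Fin n ↔ Fin n) → Graph (n + n)
prism G σ = record { Adj = prismAdj G σ ; symm = prismSymm G σ ; irrefl = prismIrrefl G σ }

UniversalFixer : ∀ {n} → Graph n → Set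
UniversalFixer {n} G =
  ∀ (σ : Fin n ↔ Fin n) (k : ℕ) → IsDominationNumber (prism G σ) k ⇔ IsDominationNumber G k

C3Free : ∀ {n} → Graph n → Fin n → Set
C3Free {n} G x =
  (∃ λ y → Adj G x y) ×
  (∀ (y z : Fin n) → Adj G x y → Adj G x z → ¬ Adj G y z)

module Submission where

-- Let y₁, …, yₘ enumerate N(x) and let π be the cycle x ↦ yₘ ↦ … ↦ y₁ ↦ x fixing every other vertex.
-- Suppose S dominates πG with |S| = γ(G). Let A = S ∩ V(G), and let C be the set of vertices v whose
-- partner π(v)' lies in S. Then A ∪ C, and also its image under π, yield dominating sets of G of size
-- at most |S| = γ(G), so nothing in them is redundant: A ∩ C = ∅, no vertex of C has a neighbour in
-- A ∪ C, and no vertex of π(A) has a neighbour in π(A ∪ C). As x lies in no triangle, π fixes every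
-- vertex at distance two from x. These constraints force x ∉ A ∪ C; then membership in A ∪ C travels
-- along the cycle from a dominator of x down to y₁, and y₁ can lie neither in A nor in C.
-- The conclusion is a negation, so decidability of adjacency to x and the existence of γ(G) may be
-- used in double-negated form.

open import Defs
open import Data.Bool using (Bool)
open import Data.Empty using (⊥; ⊥-elim)
open import Data.Fin using (Fin; zero; suc; _↑ˡ_; _↑ʳ_; splitAt)
open import Data.Fin.Permutation
  using (Permutation′; _⟨$⟩ʳ_; _⟨$⟩ˡ_; inverseˡ; inverseʳ; flip; id; _∘ₚ_; transpose)
open import Data.Fin.Properties using (_≟_; splitAt-↑ˡ; splitAt-↑ʳ; splitAt⁻¹-↑ˡ; splitAt⁻¹-↑ʳ)
open import Data.Fin.Subset using (Subset; inside; outside; ⊤; _∈_; _∉_; _∪_; _-_; ∣_∣)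
open import Data.Fin.Subset.Properties
  using (∈⊤; ∣⊤∣≡n; ∣p∣≤∣x∷p∣; x∈p∪q⁺; x∈p∧x≢y⇒x∈p-y; x∈p⇒∣p-x∣<∣p∣)
open import Data.List using (List; []; _∷_; filter; allFin)
open import Data.List.Membership.Propositional using () renaming (_∈_ to _∈ₗ_; _∉_ to _∉ₗ_)
open import Data.List.Membership.Propositional.Properties using (∈-filter⁺; ∈-filter⁻; ∈-allFin)
open import Data.List.Relation.Unary.Any using (here; there)
open import Data.List.Relation.Unary.AllPairs using (_∷_)
open import Data.List.Relation.Unary.Unique.Propositional using (Unique)
open import Data.List.Relation.Unary.Unique.Propositional.Properties
  using (Unique[x∷xs]⇒x∉xs; allFin⁺; filter⁺)
open import Data.Nat using (ℕ; zero; suc; _+_; _≤_; _<_; z≤n; s≤s)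
open import Data.Nat.Induction using (<-wellFounded)
open import Data.Nat.Properties
  using (+-comm; +-suc; ≤-trans; ≤-reflexive; ≤-<-trans; <-≤-trans; +-monoʳ-≤; +-monoʳ-<; +-0-commutativeMonoid)
open import Algebra.Properties.CommutativeMonoid.Sum +-0-commutativeMonoid using (sum; sum-cong-≗; sum-permute)
open import Data.Product using (∃; _×_; _,_; proj₂)
open import Data.Sum using (_⊎_; inj₁; inj₂)
open import Data.Vec using ([]; _∷_; lookup; tabulate)
open import Data.Vec.Properties using (lookup∘tabulate; tabulate∘lookup; []=⇒lookup; lookup⇒[]=)
open import Function using (_∘_; Injection; Equivalence)
open import Function.Properties.Inverse using (↔⇒↣)
open import Induction.WellFounded using (Acc; acc)
open import Relation.Binary.PropositionalEquality
  using (_≡_; _≢_; refl; sym; trans; cong; subst; subst₂; module ≡-Reasoning)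
open import Relation.Nullary using (¬_; Dec; yes; no; contradiction)
open import Relation.Nullary.Decidable using (dec-true; dec-false; ¬¬-excluded-middle)

∣p∪q∣≤∣p∣+∣q∣ : ∀ {n} (p q : Subset n) → ∣ p ∪ q ∣ ≤ ∣ p ∣ + ∣ q ∣
∣p∪q∣≤∣p∣+∣q∣ []            []            = z≤n
∣p∪q∣≤∣p∣+∣q∣ (inside ∷ p)  (t ∷ q)       =
  s≤s (≤-trans (∣p∪q∣≤∣p∣+∣q∣ p q) (+-monoʳ-≤ ∣ p ∣ (∣p∣≤∣x∷p∣ t q)))
∣p∪q∣≤∣p∣+∣q∣ (outside ∷ p) (inside ∷ q)  =
  ≤-trans (s≤s (∣p∪q∣≤∣p∣+∣q∣ p q)) (≤-reflexive (sym (+-suc ∣ p ∣ ∣ q ∣)))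
∣p∪q∣≤∣p∣+∣q∣ (outside ∷ p) (outside ∷ q) = ∣p∪q∣≤∣p∣+∣q∣ p q

module _ {n} {f : Fin n → Bool} {i : Fin n} where

  ∈-tabulate⁺ : f i ≡ inside → i ∈ tabulate f
  ∈-tabulate⁺ fi = lookup⇒[]= i (tabulate f) (trans (lookup∘tabulate f i) fi)

  ∈-tabulate⁻ : i ∈ tabulate f → f i ≡ inside
  ∈-tabulate⁻ i∈ = trans (sym (lookup∘tabulate f i)) ([]=⇒lookup i∈)

restrictˡ : ∀ {m} n → Subset (m + n) → Subset m
restrictˡ n S = tabulate (λ i → lookup S (i ↑ˡ n))

restrictʳ : ∀ m {n} → Subset (m + n) → Subset n
restrictʳ m S = tabulate (λ i → lookup S (m ↑ʳ i))

module _ {m n} {S : Subset (m + n)} where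

  ∈-restrictˡ⁺ : ∀ {i} → i ↑ˡ n ∈ S → i ∈ restrictˡ n S
  ∈-restrictˡ⁺ = ∈-tabulate⁺ ∘ []=⇒lookup

  ∈-restrictʳ⁺ : ∀ {i} → m ↑ʳ i ∈ S → i ∈ restrictʳ m S
  ∈-restrictʳ⁺ = ∈-tabulate⁺ ∘ []=⇒lookup

∣restrictˡ∣+∣restrictʳ∣ : ∀ m {n} (S : Subset (m + n)) → ∣ restrictˡ n S ∣ + ∣ restrictʳ m S ∣ ≡ ∣ S ∣
∣restrictˡ∣+∣restrictʳ∣ zero    S             = cong ∣_∣ (tabulate∘lookup S)
∣restrictˡ∣+∣restrictʳ∣ (suc m) (inside ∷ S)  = cong suc (∣restrictˡ∣+∣restrictʳ∣ m S)
∣restrictˡ∣+∣restrictʳ∣ (suc m) (outside ∷ S) = ∣restrictˡ∣+∣restrictʳ∣ m S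

image : ∀ {n} → Permutation′ n → Subset n → Subset n
image π A = tabulate (λ w → lookup A (π ⟨$⟩ˡ w))

module _ {n} (π : Permutation′ n) {A : Subset n} where

  ∈-image⁺ : ∀ {w} → π ⟨$⟩ˡ w ∈ A → w ∈ image π A
  ∈-image⁺ = ∈-tabulate⁺ ∘ []=⇒lookup

  ∈-image⁻ : ∀ {w} → w ∈ image π A → π ⟨$⟩ˡ w ∈ A
  ∈-image⁻ w∈ = lookup⇒[]= _ A (∈-tabulate⁻ w∈)

  ∈-image-⟨$⟩ʳ⁺ : ∀ {v} → v ∈ A → π ⟨$⟩ʳ v ∈ image π A
  ∈-image-⟨$⟩ʳ⁺ v∈A = ∈-image⁺ (subst (_∈ A) (sym (inverseˡ π)) v∈A)

  ∈-image-⟨$⟩ʳ⁻ : ∀ {v} → π ⟨$⟩ʳ v ∈ image π A → v ∈ A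
  ∈-image-⟨$⟩ʳ⁻ πv∈ = subst (_∈ A) (inverseˡ π) (∈-image⁻ πv∈)

private
  weight : Bool → ℕ
  weight inside  = 1
  weight outside = 0

  ∣p∣≡∑weight : ∀ {n} (p : Subset n) → ∣ p ∣ ≡ sum (weight ∘ lookup p)
  ∣p∣≡∑weight []            = refl
  ∣p∣≡∑weight (inside ∷ p)  = cong suc (∣p∣≡∑weight p)
  ∣p∣≡∑weight (outside ∷ p) = ∣p∣≡∑weight p

∣image∣ : ∀ {n} (π : Permutation′ n) (A : Subset n) → ∣ image π A ∣ ≡ ∣ A ∣
∣image∣ π A = begin
  ∣ image π A ∣                           ≡⟨ ∣p∣≡∑weight (image π A) ⟩
  sum (weight ∘ lookup (image π A))       ≡⟨ sum-cong-≗ (cong weight ∘ lookup∘tabulate (lookup A ∘ (π ⟨$⟩ˡ_))) ⟩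
  sum (weight ∘ lookup A ∘ (π ⟨$⟩ˡ_))     ≡⟨ sum-permute (weight ∘ lookup A) (flip π) ⟨
  sum (weight ∘ lookup A)                 ≡⟨ ∣p∣≡∑weight A ⟨
  ∣ A ∣                                   ∎
  where open ≡-Reasoning

DominatesOutside : ∀ {n} → Graph n → Subset n → Subset n → Set
DominatesOutside {n} G X Y = ∀ (v : Fin n) → v ∈ Y ⊎ v ∈ X ⊎ ∃ λ u → u ∈ X × Adj G u v

module _ {n} (G : Graph n) (X Y : Subset n) (X-dom : DominatesOutside G X Y) where

  dominating-∪- : ∀ {y} → y ∈ X ⊎ (∃ λ u → u ∈ X ∪ (Y - y) × Adj G u y) → Dominating G (X ∪ (Y - y))
  dominating-∪- {y} y-dom v with X-dom v
  ... | inj₂ (inj₁ v∈X)           = inj₁ (x∈p∪q⁺ (inj₁ v∈X))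
  ... | inj₂ (inj₂ (u , u∈X , u~v)) = inj₂ (u , x∈p∪q⁺ (inj₁ u∈X) , u~v)
  ... | inj₁ v∈Y with v ≟ y
  ...   | no v≢y = inj₁ (x∈p∪q⁺ (inj₂ (x∈p∧x≢y⇒x∈p-y v∈Y v≢y)))
  dominating-∪- y-dom v | inj₁ _ | yes refl with y-dom
  ...   | inj₁ v∈X = inj₁ (x∈p∪q⁺ (inj₁ v∈X))
  ...   | inj₂ u-dom = inj₂ u-dom

  private-outside : ∀ {k} → (∀ D → Dominating G D → ¬ ∣ D ∣ < k) → ∣ X ∣ + ∣ Y ∣ ≤ k →
                    ∀ {y} → y ∈ Y → ¬ (y ∈ X ⊎ ∃ λ u → u ∈ X ∪ (Y - y) × Adj G u y)
  private-outside γ-bound ∣X∣+∣Y∣≤k {y} y∈Y y-dom =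
    γ-bound (X ∪ (Y - y)) (dominating-∪- y-dom)
      (≤-<-trans (∣p∪q∣≤∣p∣+∣q∣ X (Y - y)) (<-≤-trans (+-monoʳ-< ∣ X ∣ (x∈p⇒∣p-x∣<∣p∣ y∈Y)) ∣X∣+∣Y∣≤k))

module _ {n} (G : Graph n) (π : Permutation′ n) where

  prism-neighbour-↑ˡ : ∀ {b} v → prismAdj G π b (v ↑ˡ n) →
                       (∃ λ u → b ≡ u ↑ˡ n × Adj G u v) ⊎ b ≡ n ↑ʳ (π ⟨$⟩ʳ v)
  prism-neighbour-↑ˡ {b} v b~v with splitAt n b in eq
  ... | inj₁ u rewrite splitAt-↑ˡ n v n = inj₁ (u , sym (splitAt⁻¹-↑ˡ eq) , b~v)
  ... | inj₂ w rewrite splitAt-↑ˡ n v n = inj₂ (trans (sym (splitAt⁻¹-↑ʳ eq)) (cong (n ↑ʳ_) (sym b~v)))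

  prism-neighbour-↑ʳ : ∀ {b} w → prismAdj G π b (n ↑ʳ w) →
                       (∃ λ u → b ≡ n ↑ʳ u × Adj G u w) ⊎ b ≡ (π ⟨$⟩ˡ w) ↑ˡ n
  prism-neighbour-↑ʳ {b} w b~w with splitAt n b in eq
  ... | inj₂ u rewrite splitAt-↑ʳ n n w = inj₁ (u , sym (splitAt⁻¹-↑ʳ eq) , b~w)
  ... | inj₁ u rewrite splitAt-↑ʳ n n w =
    inj₂ (trans (sym (splitAt⁻¹-↑ˡ eq)) (cong (_↑ˡ n) (trans (sym (inverseˡ π)) (cong (π ⟨$⟩ˡ_) b~w))))

  module _ {S : Subset (n + n)} (S-dom : Dominating (prism G π) S) where

    prism-dominating⇒dominatesOutsideˡ :
      DominatesOutside G (restrictˡ n S) (image (flip π) (restrictʳ n S))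
    prism-dominating⇒dominatesOutsideˡ v with S-dom (v ↑ˡ n)
    ... | inj₁ v∈S = inj₂ (inj₁ (∈-restrictˡ⁺ v∈S))
    ... | inj₂ (b , b∈S , b~v) with prism-neighbour-↑ˡ v b~v
    ...   | inj₁ (u , refl , u~v) = inj₂ (inj₂ (u , ∈-restrictˡ⁺ b∈S , u~v))
    ...   | inj₂ refl             = inj₁ (∈-image⁺ (flip π) (∈-restrictʳ⁺ b∈S))

    prism-dominating⇒dominatesOutsideʳ :
      DominatesOutside G (restrictʳ n S) (image π (restrictˡ n S))
    prism-dominating⇒dominatesOutsideʳ w with S-dom (n ↑ʳ w)
    ... | inj₁ w∈S = inj₂ (inj₁ (∈-restrictʳ⁺ w∈S))
    ... | inj₂ (b , b∈S , b~w) with prism-neighbour-↑ʳ w b~w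
    ...   | inj₁ (u , refl , u~w) = inj₂ (inj₂ (u , ∈-restrictʳ⁺ b∈S , u~w))
    ...   | inj₂ refl             = inj₁ (∈-image⁺ π (∈-restrictˡ⁺ b∈S))

-- B is S ∩ V(G') read back in G, and C = π⁻¹(B) consists of the v whose prism partner π(v)' lies in S.
module PrismTrace {n} (G : Graph n) (π : Permutation′ n)
                  {k} (γ-bound : ∀ D → Dominating G D → ¬ ∣ D ∣ < k)
                  {S : Subset (n + n)} (S-dom : Dominating (prism G π) S) (∣S∣≤k : ∣ S ∣ ≤ k) where

  A B C : Subset n
  A = restrictˡ n S
  B = restrictʳ n S
  C = image (flip π) B

  InTrace : Fin n → Set
  InTrace v = v ∈ A ⊎ v ∈ C

  coverˡ : DominatesOutside G A C
  coverˡ = prism-dominating⇒dominatesOutsideˡ G π S-dom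

  coverʳ : ∀ v → v ∈ C ⊎ v ∈ A ⊎ ∃ λ c → c ∈ C × Adj G (π ⟨$⟩ʳ c) (π ⟨$⟩ʳ v)
  coverʳ v with prism-dominating⇒dominatesOutsideʳ G π S-dom (π ⟨$⟩ʳ v)
  ... | inj₁ πv∈πA = inj₂ (inj₁ (∈-image-⟨$⟩ʳ⁻ π πv∈πA))
  ... | inj₂ (inj₁ πv∈B) = inj₁ (∈-image⁺ (flip π) πv∈B)
  ... | inj₂ (inj₂ (u , u∈B , u~πv)) =
    inj₂ (inj₂ (π ⟨$⟩ˡ u , ∈-image⁺ (flip π) (subst (_∈ B) (sym (inverseʳ π)) u∈B)
                        , subst (λ w → Adj G w (π ⟨$⟩ʳ v)) (sym (inverseʳ π)) u~πv))

  private
    sizeˡ : ∣ A ∣ + ∣ C ∣ ≤ k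
    sizeˡ = ≤-trans (≤-reflexive (trans (cong (∣ A ∣ +_) (∣image∣ (flip π) B))
                                        (∣restrictˡ∣+∣restrictʳ∣ n S))) ∣S∣≤k

    sizeʳ : ∣ B ∣ + ∣ image π A ∣ ≤ k
    sizeʳ = ≤-trans (≤-reflexive (trans (cong (∣ B ∣ +_) (∣image∣ π A))
                                        (trans (+-comm ∣ B ∣ ∣ A ∣) (∣restrictˡ∣+∣restrictʳ∣ n S)))) ∣S∣≤k

  A∩C-empty : ∀ {v} → v ∈ A → v ∉ C
  A∩C-empty v∈A v∈C = private-outside G A C coverˡ γ-bound sizeˡ v∈C (inj₁ v∈A)

  C-private : ∀ {c d} → c ∈ C → Adj G c d → ¬ InTrace d
  C-private {c} {d} c∈C c~d d∈AC =
    private-outside G A C coverˡ γ-bound sizeˡ c∈C (inj₂ (d , d∈A∪C-c d∈AC , symm G c~d))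
    where
    d∈A∪C-c : InTrace d → d ∈ A ∪ (C - c)
    d∈A∪C-c (inj₁ d∈A) = x∈p∪q⁺ (inj₁ d∈A)
    d∈A∪C-c (inj₂ d∈C) = x∈p∪q⁺ (inj₂ (x∈p∧x≢y⇒x∈p-y d∈C λ { refl → irrefl G c~d }))

  A-private : ∀ {a d} → a ∈ A → Adj G (π ⟨$⟩ʳ a) (π ⟨$⟩ʳ d) → ¬ InTrace d
  A-private {a} {d} a∈A πa~πd d∈AC =
    private-outside G B (image π A) (prism-dominating⇒dominatesOutsideʳ G π S-dom) γ-bound sizeʳ
      (∈-image-⟨$⟩ʳ⁺ π a∈A) (inj₂ (π ⟨$⟩ʳ d , πd∈B∪πA-πa d∈AC , symm G πa~πd))
    where
    πd∈B∪πA-πa : InTrace d → π ⟨$⟩ʳ d ∈ B ∪ (image π A - (π ⟨$⟩ʳ a))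
    πd∈B∪πA-πa (inj₁ d∈A) = x∈p∪q⁺ (inj₂ (x∈p∧x≢y⇒x∈p-y (∈-image-⟨$⟩ʳ⁺ π d∈A)
                                           λ πd≡πa → irrefl G (subst (Adj G _) πd≡πa πa~πd)))
    πd∈B∪πA-πa (inj₂ d∈C) = x∈p∪q⁺ (inj₁ (∈-image⁻ (flip π) d∈C))

module _ {n} (i j : Fin n) where

  transpose-matchˡ : transpose i j ⟨$⟩ʳ i ≡ j
  transpose-matchˡ rewrite dec-true (i ≟ i) refl = refl

  transpose-matchʳ : transpose i j ⟨$⟩ʳ j ≡ i
  transpose-matchʳ with j ≟ i
  ... | yes refl = refl
  ... | no _ rewrite dec-true (j ≟ j) refl = refl

  transpose-fix : ∀ {k} → k ≢ i → k ≢ j → transpose i j ⟨$⟩ʳ k ≡ k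
  transpose-fix {k} k≢i k≢j rewrite dec-false (k ≟ i) k≢i | dec-false (k ≟ j) k≢j = refl

-- cycle x (y₁ ∷ … ∷ yₘ) is the cycle x ↦ yₘ ↦ … ↦ y₁ ↦ x.
module _ {n} (x : Fin n) where

  cycle : List (Fin n) → Permutation′ n
  cycle []      = id
  cycle (y ∷ l) = cycle l ∘ₚ transpose x y

  cycle-fix : ∀ l {v} → v ≢ x → v ∉ₗ l → cycle l ⟨$⟩ʳ v ≡ v
  cycle-fix []      v≢x v∉l = refl
  cycle-fix (y ∷ l) v≢x v∉l = trans (cong (transpose x y ⟨$⟩ʳ_) (cycle-fix l v≢x (v∉l ∘ there)))
                                    (transpose-fix x y v≢x (v∉l ∘ here))

  cycle-head : ∀ {y} l → y ≢ x → y ∉ₗ l → cycle (y ∷ l) ⟨$⟩ʳ y ≡ x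
  cycle-head {y} l y≢x y∉l =
    trans (cong (transpose x y ⟨$⟩ʳ_) (cycle-fix l y≢x y∉l)) (transpose-matchʳ x y)

  transpose-closed : ∀ {y l v} → x ∉ₗ y ∷ l → y ∉ₗ l → v ∈ₗ x ∷ l → transpose x y ⟨$⟩ʳ v ∈ₗ x ∷ y ∷ l
  transpose-closed {y} _  _   (here refl) = there (here (transpose-matchˡ x y))
  transpose-closed {y} {l} x∉ y∉l (there v∈l) =
    there (there (subst (_∈ₗ l) (sym (transpose-fix x y (λ { refl → x∉ (there v∈l) }) (λ { refl → y∉l v∈l })))
                        v∈l))

  cycle-closed : ∀ l → Unique l → x ∉ₗ l → ∀ {u} → u ∈ₗ x ∷ l → cycle l ⟨$⟩ʳ u ∈ₗ x ∷ l
  cycle-closed []      _                   _  u∈ = u∈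
  cycle-closed (y ∷ l) uniq x∉ (there (here refl)) =
    here (cycle-head l (x∉ ∘ here ∘ sym) (Unique[x∷xs]⇒x∉xs uniq))
  cycle-closed (y ∷ l) uniq@(_ ∷ uniq-l) x∉ (here u≡x) =
    transpose-closed x∉ (Unique[x∷xs]⇒x∉xs uniq) (cycle-closed l uniq-l (x∉ ∘ there) (here u≡x))
  cycle-closed (y ∷ l) uniq@(_ ∷ uniq-l) x∉ (there (there u∈l)) =
    transpose-closed x∉ (Unique[x∷xs]⇒x∉xs uniq) (cycle-closed l uniq-l (x∉ ∘ there) (there u∈l))

  cycle-closed-∖head : ∀ {y} l → Unique (y ∷ l) → x ∉ₗ y ∷ l →
                       ∀ {u} → u ∈ₗ x ∷ y ∷ l → u ≢ y → cycle (y ∷ l) ⟨$⟩ʳ u ∈ₗ y ∷ l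
  cycle-closed-∖head {y} l uniq x∉ u∈ u≢y with cycle-closed (y ∷ l) uniq x∉ u∈
  ... | there πu∈ = πu∈
  ... | here πu≡x = contradiction (Injection.injective (↔⇒↣ (cycle (y ∷ l))) (trans πu≡x (sym πy≡x))) u≢y
    where
    πy≡x : cycle (y ∷ l) ⟨$⟩ʳ y ≡ x
    πy≡x = cycle-head l (x∉ ∘ here ∘ sym) (Unique[x∷xs]⇒x∉xs uniq)

  cycle-descends : ∀ {y} l → Unique (y ∷ l) → x ∉ₗ y ∷ l → (Q : Fin n → Set) →
                   (∀ {u} → u ∈ₗ y ∷ l → u ≢ y → Q u → Q (cycle (y ∷ l) ⟨$⟩ʳ u)) →
                   ∀ {u} → u ∈ₗ y ∷ l → Q u → Q y
  cycle-descends []      _ _ Q step (here refl) Qu = Qu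
  cycle-descends (z ∷ l) _ _ Q step (here refl) Qu = Qu
  cycle-descends {y} (z ∷ l) uniq@(_ ∷ uniq-zl) x∉ Q step (there u∈zl) Qu =
    subst Q cycle-z≡y (step (there (here refl)) (y∉zl ∘ here ∘ sym)
                            (cycle-descends l uniq-zl (x∉ ∘ there) Q step′ u∈zl Qu))
    where
    y∉zl : y ∉ₗ z ∷ l
    y∉zl = Unique[x∷xs]⇒x∉xs uniq

    cycle-z≡y : cycle (y ∷ z ∷ l) ⟨$⟩ʳ z ≡ y
    cycle-z≡y = trans (cong (transpose x y ⟨$⟩ʳ_)
                            (cycle-head l (x∉ ∘ there ∘ here ∘ sym) (Unique[x∷xs]⇒x∉xs uniq-zl)))
                      (transpose-matchˡ x y)

    -- cycle (z ∷ l) keeps u inside z ∷ l, where transpose x y acts trivially.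
    step′ : ∀ {u} → u ∈ₗ z ∷ l → u ≢ z → Q u → Q (cycle (z ∷ l) ⟨$⟩ʳ u)
    step′ {u} u∈zl u≢z Qu = subst Q (transpose-fix x y (λ v≡x → x∉ (there (subst (_∈ₗ z ∷ l) v≡x v∈zl)))
                                                            (λ v≡y → y∉zl (subst (_∈ₗ z ∷ l) v≡y v∈zl)))
                                    (step (there u∈zl) (λ { refl → y∉zl u∈zl }) Qu)
      where
      v∈zl : cycle (z ∷ l) ⟨$⟩ʳ u ∈ₗ z ∷ l
      v∈zl = cycle-closed-∖head l uniq-zl (x∉ ∘ there) (there u∈zl) u≢z

record NeighbourhoodCycle {n} (G : Graph n) (x : Fin n) : Set₁ where
  field
    π           : Permutation′ n
    y₁          : Fin n
    x~y₁        : Adj G x y₁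
    π-y₁        : π ⟨$⟩ʳ y₁ ≡ x
    x~πx        : Adj G x (π ⟨$⟩ʳ x)
    π-neighbour : ∀ {u} → Adj G x u → u ≢ y₁ → Adj G x (π ⟨$⟩ʳ u)
    π-fix       : ∀ {v} → v ≢ x → ¬ Adj G x v → π ⟨$⟩ʳ v ≡ v
    π-descends  : (Q : Fin n → Set) → (∀ {u} → Adj G x u → u ≢ y₁ → Q u → Q (π ⟨$⟩ʳ u)) →
                  ∀ {u} → Adj G x u → Q u → Q y₁

module _ {n} {G : Graph n} {x : Fin n} where

  cycle-neighbourhood : ∀ l → Unique l → (∀ {u} → u ∈ₗ l → Adj G x u) → (∀ {u} → Adj G x u → u ∈ₗ l) →
                        ∃ (Adj G x) → NeighbourhoodCycle G x
  cycle-neighbourhood []       _    _    complete (_ , x~y) with () ← complete x~y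
  cycle-neighbourhood (y₁ ∷ l) uniq sound complete _ = record
    { π           = cycle x (y₁ ∷ l)
    ; y₁          = y₁
    ; x~y₁        = sound (here refl)
    ; π-y₁        = cycle-head x l (x∉ ∘ here ∘ sym) (Unique[x∷xs]⇒x∉xs uniq)
    ; x~πx        = sound (cycle-closed-∖head x l uniq x∉ (here refl) (x∉ ∘ here))
    ; π-neighbour = λ x~u u≢y₁ → sound (cycle-closed-∖head x l uniq x∉ (there (complete x~u)) u≢y₁)
    ; π-fix       = λ v≢x x≁v → cycle-fix x (y₁ ∷ l) v≢x (x≁v ∘ sound)
    ; π-descends  = λ Q step x~u → cycle-descends x l uniq x∉ Q (λ u∈ → step (sound u∈)) (complete x~u)
    }
    where
    x∉ : x ∉ₗ y₁ ∷ l
    x∉ = irrefl G ∘ sound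

  neighbourhoodCycle : (∀ v → Dec (Adj G x v)) → ∃ (Adj G x) → NeighbourhoodCycle G x
  neighbourhoodCycle adj? = cycle-neighbourhood (filter adj? (allFin n)) (filter⁺ adj? (allFin⁺ n))
    (proj₂ ∘ ∈-filter⁻ adj? {xs = allFin n}) (∈-filter⁺ adj? (∈-allFin _))

module C3FreeArgument {n} {G : Graph n} {x : Fin n}
                      (triangle-free : ∀ y z → Adj G x y → Adj G x z → ¬ Adj G y z)
                      (adj? : ∀ v → Dec (Adj G x v)) (N : NeighbourhoodCycle G x) where

  open NeighbourhoodCycle N

  y₁≢x : y₁ ≢ x
  y₁≢x refl = irrefl G x~y₁

  π⁻¹y₁≢y₁ : π ⟨$⟩ˡ y₁ ≢ y₁
  π⁻¹y₁≢y₁ e = y₁≢x (trans (sym (inverseʳ π)) (trans (cong (π ⟨$⟩ʳ_) e) π-y₁))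

  πx~πy₁ : Adj G (π ⟨$⟩ʳ x) (π ⟨$⟩ʳ y₁)
  πx~πy₁ = subst (Adj G _) (sym π-y₁) (symm G x~πx)

  π-fix-at-distance-two : ∀ {a y} → a ≢ x → Adj G x y → Adj G a y → π ⟨$⟩ʳ a ≡ a
  π-fix-at-distance-two a≢x x~y a~y = π-fix a≢x (λ x~a → triangle-free _ _ x~a x~y a~y)

  module _ {k} (γ-bound : ∀ D → Dominating G D → ¬ ∣ D ∣ < k)
           {S : Subset (n + n)} (S-dom : Dominating (prism G π) S) (∣S∣≤k : ∣ S ∣ ≤ k) where

    open PrismTrace G π γ-bound S-dom ∣S∣≤k

    A-distance-two : ∀ {a u} → a ∈ A → a ≢ x → Adj G a (π ⟨$⟩ʳ u) → Adj G x (π ⟨$⟩ʳ u) → ¬ InTrace u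
    A-distance-two {a} {u} a∈A a≢x a~πu x~πu =
      A-private a∈A (subst (λ z → Adj G z (π ⟨$⟩ʳ u)) (sym (π-fix-at-distance-two a≢x x~πu a~πu)) a~πu)

    x∉C : x ∉ C
    x∉C x∈C with coverˡ (π ⟨$⟩ʳ x)
    ... | inj₁ πx∈C                  = C-private x∈C x~πx (inj₂ πx∈C)
    ... | inj₂ (inj₁ πx∈A)           = C-private x∈C x~πx (inj₁ πx∈A)
    ... | inj₂ (inj₂ (a , a∈A , a~πx)) with a ≟ x
    ...   | yes refl = A∩C-empty a∈A x∈C
    ...   | no a≢x   = A-distance-two a∈A a≢x a~πx x~πx (inj₂ x∈C)

    x∉A : x ∉ A
    x∉A x∈A with coverʳ y₁
    ... | inj₁ y₁∈C                  = A-private x∈A πx~πy₁ (inj₂ y₁∈C)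
    ... | inj₂ (inj₁ y₁∈A)           = A-private x∈A πx~πy₁ (inj₁ y₁∈A)
    ... | inj₂ (inj₂ (c , c∈C , πc~πy₁)) with c ≟ x | adj? c
    ...   | yes refl | _       = x∉C c∈C
    ...   | no _     | yes x~c = C-private c∈C (symm G x~c) (inj₁ x∈A)
    ...   | no c≢x   | no x≁c  = x≁c (symm G (subst₂ (Adj G) (π-fix c≢x x≁c) π-y₁ πc~πy₁))

    y₁-traced : ∀ {a} → a ∈ A → Adj G a x → InTrace y₁
    y₁-traced a∈A a~x = π-descends InTrace step (symm G a~x) (inj₁ a∈A)
      where
      step : ∀ {u} → Adj G x u → u ≢ y₁ → InTrace u → InTrace (π ⟨$⟩ʳ u)
      step {u} x~u u≢y₁ u-traced with coverˡ (π ⟨$⟩ʳ u)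
      ... | inj₁ πu∈C                  = inj₂ πu∈C
      ... | inj₂ (inj₁ πu∈A)           = inj₁ πu∈A
      ... | inj₂ (inj₂ (a , a∈A , a~πu)) with a ≟ x
      ...   | yes refl = ⊥-elim (x∉A a∈A)
      ...   | no a≢x   = ⊥-elim (A-distance-two a∈A a≢x a~πu (π-neighbour x~u u≢y₁) u-traced)

    y₁∉C : ∀ {a} → a ∈ A → Adj G a x → y₁ ∉ C
    y₁∉C {a} a∈A a~x y₁∈C with a ≟ y₁
    ... | yes refl = A∩C-empty a∈A y₁∈C
    ... | no a≢y₁  =
      A-private a∈A (subst (Adj G _) (sym π-y₁) (symm G (π-neighbour (symm G a~x) a≢y₁))) (inj₂ y₁∈C)

    x-untraced : ¬ InTrace x
    x-untraced (inj₁ x∈A) = x∉A x∈A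
    x-untraced (inj₂ x∈C) = x∉C x∈C

    π⁻¹y₁-untraced : y₁ ∈ A → ¬ InTrace (π ⟨$⟩ˡ y₁)
    π⁻¹y₁-untraced y₁∈A u-traced with π ⟨$⟩ˡ y₁ ≟ x | adj? (π ⟨$⟩ˡ y₁)
    ... | yes u≡x | _       = x-untraced (subst InTrace u≡x u-traced)
    ... | no u≢x  | no x≁u  = π⁻¹y₁≢y₁ (trans (sym (π-fix u≢x x≁u)) (inverseʳ π))
    ... | no _    | yes x~u =
      A-private y₁∈A (subst (λ z → Adj G z _) (sym π-y₁) (π-neighbour x~u π⁻¹y₁≢y₁)) u-traced

    y₁∉A : y₁ ∉ A
    y₁∉A y₁∈A with coverʳ (π ⟨$⟩ˡ y₁)
    ... | inj₁ u∈C                     = π⁻¹y₁-untraced y₁∈A (inj₂ u∈C)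
    ... | inj₂ (inj₁ u∈A)              = π⁻¹y₁-untraced y₁∈A (inj₁ u∈A)
    ... | inj₂ (inj₂ (c , c∈C , πc~πu)) with c ≟ y₁
    ...   | yes refl = A∩C-empty y₁∈A c∈C
    ...   | no c≢y₁  = C-private c∈C (subst (λ z → Adj G z y₁) (π-fix c≢x x≁c) πc~y₁) (inj₁ y₁∈A)
      where
      πc~y₁ : Adj G (π ⟨$⟩ʳ c) y₁
      πc~y₁ = subst (Adj G _) (inverseʳ π) πc~πu
      x≁πc : ¬ Adj G x (π ⟨$⟩ʳ c)
      x≁πc x~πc = triangle-free _ _ x~y₁ x~πc (symm G πc~y₁)
      c≢x : c ≢ x
      c≢x refl = x≁πc x~πx
      x≁c : ¬ Adj G x c
      x≁c x~c = x≁πc (π-neighbour x~c c≢y₁)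

    S-too-small : ⊥
    S-too-small with coverˡ x
    ... | inj₁ x∈C                   = x∉C x∈C
    ... | inj₂ (inj₁ x∈A)            = x∉A x∈A
    ... | inj₂ (inj₂ (a , a∈A , a~x)) with y₁-traced a∈A a~x
    ...   | inj₁ y₁∈A = y₁∉A y₁∈A
    ...   | inj₂ y₁∈C = y₁∉C a∈A a~x y₁∈C

  γ<∣prism-dominating∣ : ∀ {k} → (∀ D → Dominating G D → ¬ ∣ D ∣ < k) →
                         ∀ {S} → Dominating (prism G π) S → ¬ ∣ S ∣ ≤ k
  γ<∣prism-dominating∣ = S-too-small

¬¬-∀-Fin : ∀ {n} {P : Fin n → Set} → (∀ i → ¬ ¬ P i) → ¬ ¬ (∀ i → P i)
¬¬-∀-Fin {zero}  _   ¬∀ = ¬∀ λ ()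
¬¬-∀-Fin {suc n} ¬¬P ¬∀ = ¬¬P zero λ P0 → ¬¬-∀-Fin (¬¬P ∘ suc) λ P+ → ¬∀ λ { zero → P0 ; (suc i) → P+ i }

¬¬-least : ∀ {P : ℕ → Set} {m} → P m → ¬ ¬ (∃ λ k → P k × (∀ {j} → j < k → ¬ P j))
¬¬-least {P} = go (<-wellFounded _)
  where
  go : ∀ {m} → Acc _<_ m → P m → ¬ ¬ (∃ λ k → P k × (∀ {j} → j < k → ¬ P j))
  go {m} (acc smaller) Pm ¬least = ¬¬-excluded-middle {A = ∃ λ j → j < m × P j} λ
    { (yes (j , j<m , Pj)) → go (smaller j<m) Pj ¬least
    ; (no ∄smaller)        → ¬least (m , Pm , λ j<m Pj → ∄smaller (_ , j<m , Pj)) }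

¬¬-dominationNumber : ∀ {n} (G : Graph n) → ¬ ¬ ∃ (IsDominationNumber G)
¬¬-dominationNumber {n} G ¬γ = ¬¬-least {P = λ k → ∃ λ D → Dominating G D × ∣ D ∣ ≡ k} {n}
  (⊤ , (λ _ → inj₁ ∈⊤) , ∣⊤∣≡n n)
  λ (k , D-min , minimal) → ¬γ (k , D-min , λ D D-dom ∣D∣<k → minimal ∣D∣<k (D , D-dom , refl))

theorem3 : ∀ {n : ℕ} (G : Graph n) (x : Fin n) → C3Free G x → ¬ UniversalFixer G
theorem3 G x (neighbour , triangle-free) fixer =
  ¬¬-∀-Fin (λ _ → ¬¬-excluded-middle) λ adj? →
  ¬¬-dominationNumber G λ (k , γ≡k) →
  let N = neighbourhoodCycle adj? neighbour
      ((S , S-dom , ∣S∣≡k) , _) = Equivalence.from (fixer (NeighbourhoodCycle.π N) k) γ≡k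
  in C3FreeArgument.γ<∣prism-dominating∣ triangle-free adj? N (proj₂ γ≡k) S-dom (≤-reflexive ∣S∣≡k)
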